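{- For every integer $m\ge1$ and every circular sequence of integers $\epsilon=(\epsilon_1,\dots,\epsilon_s)$, if $\Gamma^m_\epsilon$ contains a circular digraph, then every circular digraph of $\Gamma^m_\epsilon$ contains exactly $s$ vertices and $\sum_{i=1}^s\epsilon_i=0$.
   Context: Digraph $\Gamma^m_\epsilon$ of a circular integer sequence $\epsilon=(\epsilon_1,\dots,\epsilon_s)$ (indices mod $s$): vertices $x_{i,t}$, $0\le i\le m-1$, $t\in\{1,\dots,s\}$, some "marked zero". If $s=1$: if $\epsilon_1\ne0$ all vertices are marked zero and there are no edges; if $\epsilon_1=0$ nothing is marked and each $x_{i,1}$ carries a loop of weight $0$. If $s\ge2$: for each $t$ let $A_t=\max(\epsilon_t,0)$, $B_t=\max(-\epsilon_{t+1},0)$; for each $j\in\{0,\dots,m-1\}$: if $j\ge\max(A_t,B_t)$ add an edge from $x_{j-A_t,t}$ to $x_{j-B_t,t+1}$ of weight $A_t-B_t$; if $A_t\le j<B_t$ mark $x_{j-A_t,t}$ zero; if $B_t\le j<A_t$ mark $x_{j-B_t,t+1}$ zero. Each vertex is source and target of at most one edge, so each connected component is a directed path (linear digraph) or a directed cycle (circular digraph). -}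

module Defs where

open import Data.Nat using (ℕ; zero; suc; _≤_; _<_; _∸_)
open import Data.Nat.DivMod using (_%_; m%n<n)
open import Data.Fin using (Fin; toℕ; fromℕ<)
open import Data.Integer using (ℤ; +_; -[1+_]; -_; _+_; 0ℤ)
open import Data.Product using (Σ; ∃; _×_; _,_)
open import Data.Sum using (_⊎_)
open import Relation.Binary.PropositionalEquality using (_≡_)

-- Indices of the circular sequence ε = (ε_1,…,ε_s) with s = suc n are
-- represented by Fin (suc n) (position t ↦ t-1); indices are taken mod s.
next : {n : ℕ} → Fin (suc n) → Fin (suc n)
next {n} t = fromℕ< (m%n<n (suc (toℕ t)) (suc n))

posPart : ℤ → ℕ
posPart (+ k) = k
posPart -[1+ k ] = 0

-- Vertex x_{i,t} of Γ^m_ε is the pair (i , t).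
Vertex : ℕ → ℕ → Set
Vertex m s = Fin m × Fin s

A : {n : ℕ} → (Fin (suc n) → ℤ) → Fin (suc n) → ℕ
A ε t = posPart (ε t)

B : {n : ℕ} → (Fin (suc n) → ℤ) → Fin (suc n) → ℕ
B ε t = posPart (- ε (next t))

data Edge (m : ℕ) {n : ℕ} (ε : Fin (suc n) → ℤ) :
          Vertex m (suc n) → Vertex m (suc n) → Set where
  loop : n ≡ 0 → (t : Fin (suc n)) → ε t ≡ 0ℤ → (i : Fin m) →
         Edge m ε (i , t) (i , t)
  step : 1 ≤ n → (t : Fin (suc n)) (j : ℕ) → j < m →
         A ε t ≤ j → B ε t ≤ j → (u v : Fin m) →
         toℕ u ≡ j ∸ A ε t → toℕ v ≡ j ∸ B ε t →
         Edge m ε (u , t) (v , next t)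

-- A circular digraph of Γ^m_ε: a connected component which is a directed
-- cycle.  It is given by k+1 pairwise distinct vertices v_0,…,v_k with edges
-- v_i → v_{i+1 mod (k+1)}, such that the vertex set is closed under
-- adjacency (so it is a whole connected component).
record CircularDigraph (m : ℕ) {n : ℕ} (ε : Fin (suc n) → ℤ) : Set where
  field
    k        : ℕ
    vert     : Fin (suc k) → Vertex m (suc n)
    distinct : ∀ i j → vert i ≡ vert j → i ≡ j
    edges    : ∀ i → Edge m ε (vert i) (vert (next i))
    closed   : ∀ u v → Edge m ε u v →
               (∃ λ i → vert i ≡ u) ⊎ (∃ λ i → vert i ≡ v) →
               (∃ λ i → vert i ≡ u) × (∃ λ i → vert i ≡ v)

  size : ℕ
  size = suc k

sumℤ : {n : ℕ} → (Fin n → ℤ) → ℤ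
sumℤ {zero} f = 0ℤ
sumℤ {suc n} f = f Fin.zero + sumℤ (λ i → f (Fin.suc i))

module Submission where

-- Put a potential on the vertices of Γ^m_ε,
--   Φ(x_{i,t}) = i + max(-ε_t, 0),
-- so that along every edge x_{i,t} → x_{i',t+1} the index t advances by one
-- and Φ grows by exactly ε_t.  Walk around a circular digraph C with K
-- vertices, starting at a vertex with index t₀.  After p steps the index is
-- t₀ + p mod s and Φ has grown by ε_{t₀} + … + ε_{t₀+p-1}.
--   * After K steps the walk is back, so t₀ + K ≡ t₀ (mod s), i.e. s ∣ K.
--   * Writing K = j·s (j ≥ 1), these K steps run j times around ε, so
--     j·Σε = 0 and hence Σε = 0.
--   * Then after s steps both the index and Φ are back to their initial
--     values; as a vertex is determined by these two, the walk is back after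
--     s steps, and distinctness of the vertices of C gives K ∣ s.

open import Defs
open import Data.Nat using (ℕ; suc; _≤_)
open import Data.Fin using (Fin)
open import Data.Integer using (ℤ; 0ℤ)
open import Data.Product using (_×_)
open import Relation.Binary.PropositionalEquality using (_≡_)

open import Data.Nat as ℕ using (zero; _∸_; NonZero)
import Data.Nat.Properties as ℕP
open import Data.Nat.DivMod using (_%_; m%n<n; %-distribˡ-+; [m+n]%n≡m%n; m%n%n≡m%n; m<n⇒m%n≡m; n%n≡0)
open import Data.Nat.Divisibility using (_∣_; divides; m%n≡0⇒n∣m; ∣-antisym)
open import Data.Fin using (toℕ; fromℕ<) renaming (zero to fzero; suc to fsuc)
open import Data.Fin.Properties using (toℕ-injective; toℕ-fromℕ<; toℕ<n)
open import Data.Integer using (+_; -[1+_]; -_; _+_; _*_)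
import Data.Integer.Properties as ℤP
open import Algebra.Properties.AbelianGroup ℤP.+-0-abelianGroup using (∙-cancelˡ; ∙-cancelʳ)
open import Data.Product using (_,_; proj₁; proj₂)
open import Data.Sum using (inj₁; inj₂)
open import Relation.Binary.PropositionalEquality using (refl; sym; trans; cong; cong₂; subst; module ≡-Reasoning)
open import Function using (_∘_)

sumTo : (ℕ → ℤ) → ℕ → ℤ
sumTo h zero    = 0ℤ
sumTo h (suc p) = h 0 + sumTo (λ q → h (suc q)) p

sumTo-cong : ∀ {h h′ : ℕ → ℤ} → (∀ q → h q ≡ h′ q) → ∀ p → sumTo h p ≡ sumTo h′ p
sumTo-cong e zero    = refl
sumTo-cong e (suc p) = cong₂ _+_ (e 0) (sumTo-cong (λ q → e (suc q)) p)

sumTo-snoc : ∀ (h : ℕ → ℤ) p → sumTo h (suc p) ≡ sumTo h p + h p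
sumTo-snoc h zero    = trans (ℤP.+-identityʳ (h 0)) (sym (ℤP.+-identityˡ (h 0)))
sumTo-snoc h (suc p) = trans (cong (λ w → h 0 + w) (sumTo-snoc (λ q → h (suc q)) p))
                             (sym (ℤP.+-assoc (h 0) _ _))

sumTo-+ : ∀ (h : ℕ → ℤ) a b → sumTo h (a ℕ.+ b) ≡ sumTo h a + sumTo (λ q → h (a ℕ.+ q)) b
sumTo-+ h zero    b = sym (ℤP.+-identityˡ _)
sumTo-+ h (suc a) b = trans (cong (λ w → h 0 + w) (sumTo-+ (λ q → h (suc q)) a b))
                            (sym (ℤP.+-assoc (h 0) _ _))

telescope : ∀ (x d : ℕ → ℤ) → (∀ p → x (suc p) ≡ x p + d p) →
            ∀ p → x p ≡ x 0 + sumTo d p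
telescope x d increment zero    = sym (ℤP.+-identityʳ (x 0))
telescope x d increment (suc p) = begin
    x (suc p)
      ≡⟨ telescope (λ q → x (suc q)) (λ q → d (suc q)) (λ q → increment (suc q)) p ⟩
    x 1 + sumTo (λ q → d (suc q)) p
      ≡⟨ cong (_+ sumTo (λ q → d (suc q)) p) (increment 0) ⟩
    (x 0 + d 0) + sumTo (λ q → d (suc q)) p
      ≡⟨ ℤP.+-assoc (x 0) (d 0) _ ⟩
    x 0 + sumTo d (suc p) ∎
  where open ≡-Reasoning

Periodic : ℕ → (ℕ → ℤ) → Set
Periodic s h = ∀ q → h (q ℕ.+ s) ≡ h q

periodic-shift : ∀ {s h} → Periodic s h → ∀ a → Periodic s (λ q → h (a ℕ.+ q))
periodic-shift {s} {h} per a q = trans (cong h (sym (ℕP.+-assoc a q s))) (per (a ℕ.+ q))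

sumTo-window : ∀ {s h} → Periodic s h → ∀ a → sumTo (λ q → h (a ℕ.+ q)) s ≡ sumTo h s
sumTo-window         per zero    = refl
sumTo-window {s} {h} per (suc a) = trans (∙-cancelˡ (h a) _ _ slide) (sumTo-window per a)
  where
  -- both sides are the sum over the window [a, a + s]
  slide : h a + sumTo (λ q → h (suc a ℕ.+ q)) s ≡ h a + sumTo (λ q → h (a ℕ.+ q)) s
  slide = begin
      h a + sumTo (λ q → h (suc a ℕ.+ q)) s
    ≡⟨ cong₂ _+_ (cong h (sym (ℕP.+-identityʳ a)))
                 (sumTo-cong (λ q → cong h (sym (ℕP.+-suc a q))) s) ⟩
      sumTo (λ q → h (a ℕ.+ q)) (suc s)
    ≡⟨ sumTo-snoc (λ q → h (a ℕ.+ q)) s ⟩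
      sumTo (λ q → h (a ℕ.+ q)) s + h (a ℕ.+ s)
    ≡⟨ cong (λ w → sumTo (λ q → h (a ℕ.+ q)) s + w) (per a) ⟩
      sumTo (λ q → h (a ℕ.+ q)) s + h a
    ≡⟨ ℤP.+-comm _ (h a) ⟩
      h a + sumTo (λ q → h (a ℕ.+ q)) s ∎
    where open ≡-Reasoning

sumTo-periods : ∀ {s h} → Periodic s h → ∀ j → sumTo h (j ℕ.* s) ≡ + j * sumTo h s
sumTo-periods         per zero    = refl
sumTo-periods {s} {h} per (suc j) = begin
    sumTo h (s ℕ.+ j ℕ.* s)                         ≡⟨ sumTo-+ h s (j ℕ.* s) ⟩
    sumTo h s + sumTo (λ q → h (s ℕ.+ q)) (j ℕ.* s) ≡⟨ cong (λ w → sumTo h s + w) (sumTo-cong shifted (j ℕ.* s)) ⟩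
    sumTo h s + sumTo h (j ℕ.* s)                   ≡⟨ cong (λ w → sumTo h s + w) (sumTo-periods per j) ⟩
    sumTo h s + + j * sumTo h s                     ≡⟨ sym (ℤP.suc-* (+ j) (sumTo h s)) ⟩
    + suc j * sumTo h s                             ∎
  where
  open ≡-Reasoning
  shifted : ∀ q → h (s ℕ.+ q) ≡ h q
  shifted q = trans (cong h (ℕP.+-comm s q)) (per q)

sumℤ-as-sumTo : ∀ {n} (f : Fin n → ℤ) (h : ℕ → ℤ) → (∀ i → h (toℕ i) ≡ f i) →
                sumTo h n ≡ sumℤ f
sumℤ-as-sumTo {zero}  f h e = refl
sumℤ-as-sumTo {suc n} f h e =
  cong₂ _+_ (e fzero) (sumℤ-as-sumTo (λ i → f (fsuc i)) (λ q → h (suc q)) (λ i → e (fsuc i)))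

%-cong-+ˡ : ∀ x {y z} d .{{_ : NonZero d}} → y % d ≡ z % d → (x ℕ.+ y) % d ≡ (x ℕ.+ z) % d
%-cong-+ˡ x {y} {z} d e = begin
  (x ℕ.+ y) % d           ≡⟨ %-distribˡ-+ x y d ⟩
  (x % d ℕ.+ y % d) % d   ≡⟨ cong (λ r → (x % d ℕ.+ r) % d) e ⟩
  (x % d ℕ.+ z % d) % d   ≡⟨ sym (%-distribˡ-+ x z d) ⟩
  (x ℕ.+ z) % d           ∎
  where open ≡-Reasoning

%-cancel-+ˡ : ∀ {a} p d .{{_ : NonZero d}} → a ≤ d → (a ℕ.+ p) % d ≡ a % d → d ∣ p
%-cancel-+ˡ {a} p d a≤d e = m%n≡0⇒n∣m p d (begin
  p % d                         ≡⟨ sym ([m+n]%n≡m%n p d) ⟩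
  (p ℕ.+ d) % d                 ≡⟨ cong (_% d) rearrange ⟩
  ((d ∸ a) ℕ.+ (a ℕ.+ p)) % d   ≡⟨ %-cong-+ˡ (d ∸ a) d e ⟩
  ((d ∸ a) ℕ.+ a) % d           ≡⟨ cong (_% d) (ℕP.m∸n+n≡m a≤d) ⟩
  d % d                         ≡⟨ n%n≡0 d ⟩
  0                             ∎)
  where
  open ≡-Reasoning
  rearrange : p ℕ.+ d ≡ (d ∸ a) ℕ.+ (a ℕ.+ p)
  rearrange = begin
    p ℕ.+ d                     ≡⟨ ℕP.+-comm p d ⟩
    d ℕ.+ p                     ≡⟨ cong (ℕ._+ p) (sym (ℕP.m∸n+n≡m a≤d)) ⟩
    ((d ∸ a) ℕ.+ a) ℕ.+ p       ≡⟨ ℕP.+-assoc (d ∸ a) a p ⟩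
    (d ∸ a) ℕ.+ (a ℕ.+ p)       ∎

-- The residue of p modulo suc n, as an element of Fin (suc n).
-- Note that next t is fromMod (suc (toℕ t)) by definition.
fromMod : ∀ {n} → ℕ → Fin (suc n)
fromMod {n} p = fromℕ< (m%n<n p (suc n))

toℕ-fromMod : ∀ {n} p → toℕ (fromMod {n} p) ≡ p % suc n
toℕ-fromMod {n} p = toℕ-fromℕ< (m%n<n p (suc n))

fromMod-toℕ : ∀ {n} (t : Fin (suc n)) → fromMod (toℕ t) ≡ t
fromMod-toℕ t = toℕ-injective (trans (toℕ-fromMod (toℕ t)) (m<n⇒m%n≡m (toℕ<n t)))

fromMod-period : ∀ {n} p → fromMod {n} (p ℕ.+ suc n) ≡ fromMod p
fromMod-period {n} p =
  toℕ-injective (trans (toℕ-fromMod (p ℕ.+ suc n)) (trans ([m+n]%n≡m%n p (suc n)) (sym (toℕ-fromMod p))))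

next-fromMod : ∀ {n} p → next (fromMod {n} p) ≡ fromMod (suc p)
next-fromMod {n} p = toℕ-injective (begin
  toℕ (next (fromMod p))          ≡⟨ toℕ-fromMod (suc (toℕ (fromMod p))) ⟩
  suc (toℕ (fromMod p)) % suc n   ≡⟨ cong (λ r → suc r % suc n) (toℕ-fromMod p) ⟩
  (1 ℕ.+ p % suc n) % suc n       ≡⟨ %-cong-+ˡ 1 (suc n) (m%n%n≡m%n p (suc n)) ⟩
  suc p % suc n                   ≡⟨ sym (toℕ-fromMod (suc p)) ⟩
  toℕ (fromMod (suc p))           ∎)
  where open ≡-Reasoning

fromMod-return : ∀ {n} (t : Fin (suc n)) p → fromMod (toℕ t ℕ.+ p) ≡ t → suc n ∣ p
fromMod-return {n} t p e = %-cancel-+ˡ p (suc n) (ℕP.<⇒≤ (toℕ<n t))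
  (trans (sym (toℕ-fromMod (toℕ t ℕ.+ p)))
         (trans (cong toℕ (trans e (sym (fromMod-toℕ t)))) (toℕ-fromMod (toℕ t))))

posPart-split : ∀ z → + posPart z ≡ + posPart (- z) + z
posPart-split (+ zero)  = refl
posPart-split (+ suc k) = refl
posPart-split -[1+ k ]  = sym (ℤP.+-inverseʳ (+ suc k))

potential : ∀ {m n} → (Fin (suc n) → ℤ) → Vertex m (suc n) → ℤ
potential ε (i , t) = + toℕ i + + posPart (- ε t)

edge-step : ∀ {m n} {ε : Fin (suc n) → ℤ} {u v : Vertex m (suc n)} → Edge m ε u v →
            (proj₂ v ≡ next (proj₂ u)) × (potential ε v ≡ potential ε u + ε (proj₂ u))
edge-step {ε = ε} (loop refl fzero ε≡0 i) =
  refl , sym (trans (cong (λ w → potential ε (i , fzero) + w) ε≡0) (ℤP.+-identityʳ _))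
edge-step {ε = ε} (step _ t j _ A≤j B≤j u v u≡j-A v≡j-B) = refl , (begin
    + toℕ v + + B ε t                    ≡⟨⟩
    + (toℕ v ℕ.+ B ε t)                  ≡⟨ cong +_ level ⟩
    + toℕ u + + posPart (ε t)            ≡⟨ cong (λ w → + toℕ u + w) (posPart-split (ε t)) ⟩
    + toℕ u + (+ posPart (- ε t) + ε t)  ≡⟨ sym (ℤP.+-assoc (+ toℕ u) (+ posPart (- ε t)) (ε t)) ⟩
    potential ε (u , t) + ε t            ∎)
  where
  open ≡-Reasoning
  -- both sides equal j
  level : toℕ v ℕ.+ B ε t ≡ toℕ u ℕ.+ A ε t
  level = trans (cong (ℕ._+ B ε t) v≡j-B)
                (trans (ℕP.m∸n+n≡m B≤j) (sym (trans (cong (ℕ._+ A ε t) u≡j-A) (ℕP.m∸n+n≡m A≤j))))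

potential-injective : ∀ {m n} (ε : Fin (suc n) → ℤ) {u v : Vertex m (suc n)} →
                      proj₂ u ≡ proj₂ v → potential ε u ≡ potential ε v → u ≡ v
potential-injective ε {i , t} {i′ , .t} refl e =
  cong (_, t) (toℕ-injective (ℤP.+-injective (∙-cancelʳ (+ posPart (- ε t)) _ _ e)))

module Walk {m n : ℕ} (ε : Fin (suc n) → ℤ) (C : CircularDigraph m ε) where
  open CircularDigraph C

  V : ℕ → Vertex m (suc n)
  V p = vert (fromMod p)

  walk-edge : ∀ p → Edge m ε (V p) (V (suc p))
  walk-edge p = subst (Edge m ε (V p) ∘ vert) (next-fromMod p) (edges (fromMod p))

  walk-closes : V (suc k) ≡ V 0
  walk-closes = cong vert (fromMod-period 0)

  index : ℕ → Fin (suc n)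
  index p = proj₂ (V p)

  t₀ : ℕ
  t₀ = toℕ (index 0)

  index-walk : ∀ p → index p ≡ fromMod (t₀ ℕ.+ p)
  index-walk zero    = sym (trans (cong fromMod (ℕP.+-identityʳ t₀)) (fromMod-toℕ (index 0)))
  index-walk (suc p) = begin
    index (suc p)              ≡⟨ proj₁ (edge-step (walk-edge p)) ⟩
    next (index p)             ≡⟨ cong next (index-walk p) ⟩
    next (fromMod (t₀ ℕ.+ p))  ≡⟨ next-fromMod (t₀ ℕ.+ p) ⟩
    fromMod (suc (t₀ ℕ.+ p))   ≡⟨ cong fromMod (sym (ℕP.+-suc t₀ p)) ⟩
    fromMod (t₀ ℕ.+ suc p)     ∎
    where open ≡-Reasoning

  ε-mod : ℕ → ℤ
  ε-mod q = ε (fromMod q)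

  ε-mod-periodic : Periodic (suc n) ε-mod
  ε-mod-periodic q = cong ε (fromMod-period q)

  ε-along : ℕ → ℤ
  ε-along q = ε-mod (t₀ ℕ.+ q)

  ε-along-periodic : Periodic (suc n) ε-along
  ε-along-periodic = periodic-shift ε-mod-periodic t₀

  ε-along-turn : sumTo ε-along (suc n) ≡ sumℤ ε
  ε-along-turn = trans (sumTo-window ε-mod-periodic t₀)
                       (sumℤ-as-sumTo ε ε-mod (λ t → cong ε (fromMod-toℕ t)))

  potential-walk : ∀ p → potential ε (V p) ≡ potential ε (V 0) + sumTo ε-along p
  potential-walk p = trans (telescope (λ q → potential ε (V q)) (λ q → ε (index q)) increment p)
                           (cong (λ w → potential ε (V 0) + w) (sumTo-cong (cong ε ∘ index-walk) p))
    where
    increment : ∀ q → potential ε (V (suc q)) ≡ potential ε (V q) + ε (index q)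
    increment q = proj₂ (edge-step (walk-edge q))

  -- s ∣ K: the index returns to t₀ after K steps
  s∣size : suc n ∣ size
  s∣size = fromMod-return (index 0) size (trans (sym (index-walk size)) (cong proj₂ walk-closes))

  -- Writing K = j·s, the K steps back to the start wind j times around ε.
  sum-zero : sumℤ ε ≡ 0ℤ
  sum-zero = winding s∣size
    where
    winding : suc n ∣ size → sumℤ ε ≡ 0ℤ
    winding (divides zero ())
    winding (divides (suc j) size≡js) with ℤP.i*j≡0⇒i≡0∨j≡0 (+ suc j) windings≡0
      where
      windings≡0 : + suc j * sumℤ ε ≡ 0ℤ
      windings≡0 = ∙-cancelˡ (potential ε (V 0)) _ _ (begin
        potential ε (V 0) + + suc j * sumℤ ε
          ≡⟨ cong (λ w → potential ε (V 0) + + suc j * w) (sym ε-along-turn) ⟩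
        potential ε (V 0) + + suc j * sumTo ε-along (suc n)
          ≡⟨ cong (λ w → potential ε (V 0) + w) (sym (sumTo-periods ε-along-periodic (suc j))) ⟩
        potential ε (V 0) + sumTo ε-along (suc j ℕ.* suc n)
          ≡⟨ sym (potential-walk (suc j ℕ.* suc n)) ⟩
        potential ε (V (suc j ℕ.* suc n))
          ≡⟨ cong (potential ε ∘ V) (sym size≡js) ⟩
        potential ε (V size)
          ≡⟨ cong (potential ε) walk-closes ⟩
        potential ε (V 0)
          ≡⟨ sym (ℤP.+-identityʳ _) ⟩
        potential ε (V 0) + 0ℤ ∎)
        where open ≡-Reasoning
    ... | inj₁ ()
    ... | inj₂ Σε≡0 = Σε≡0

  -- Since Σε = 0, after s steps index and potential are back, hence the vertex.
  returns-after-s : V (suc n) ≡ V 0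
  returns-after-s = potential-injective ε same-index same-potential
    where
    same-index : index (suc n) ≡ index 0
    same-index = trans (index-walk (suc n)) (trans (fromMod-period t₀) (fromMod-toℕ (index 0)))
    same-potential : potential ε (V (suc n)) ≡ potential ε (V 0)
    same-potential = trans (potential-walk (suc n))
      (trans (cong (λ w → potential ε (V 0) + w) (trans ε-along-turn sum-zero)) (ℤP.+-identityʳ _))

  -- K ∣ s: the K vertices of C are distinct, so returning after s steps needs K ∣ s.
  size∣s : size ∣ suc n
  size∣s = fromMod-return fzero (suc n) (distinct (fromMod (suc n)) (fromMod 0) returns-after-s)

  size≡s : size ≡ suc n
  size≡s = ∣-antisym size∣s s∣size

proposition3p3 : (m : ℕ) → 1 ≤ m → (n : ℕ) → (ε : Fin (suc n) → ℤ) →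
    CircularDigraph m ε →
    ((C : CircularDigraph m ε) → CircularDigraph.size C ≡ suc n) × sumℤ ε ≡ 0ℤ
proposition3p3 m _ n ε C = Walk.size≡s ε , Walk.sum-zero ε C
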